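{- Let $\mathbf a\in(\mathbb{Z}_{\ge0})^n$ have its nonzero entries exactly in positions $s_1,s_2,\dots,s_k$. Then the number of $\mathbf a$-Tesler tableaux of dimension $0$ equals the number of pairs $(V,F)$ where $\{s_1,\dots,s_k\}\subseteq V\subseteq[n]$ and $F$ is a decreasing forest on $V$ all of whose leaves lie in $\{s_1,\dots,s_k\}$.
   Context: The shifted staircase of size $n$ consists of cells $(i,j)$ with $1\le i\le j\le n$. For $\mathbf a=(a_1,\dots,a_n)\in(\mathbb{Z}_{\ge0})^n$, an $\mathbf a$-Tesler tableau is a filling $T$ of the shifted staircase with entries in $\{0,1\}$ such that: (1) for $1\le i\le n$, if $a_i>0$ then row $i$ contains at least one $1$; (2) for $1\le i<j\le n$, if $T(i,j)=1$ then row $j$ contains at least one $1$; (3) for $1\le j\le n$, if $a_j=0$ and $T(i,j)=0$ for all $1\le i<j$, then $T(j,k)=0$ for all $j\le k\le n$. The dimension of $T$ is the number of $1$'s in $T$ minus the number of nonzero rows of $T$. A decreasing forest on a set $V\subseteq[n]$ is a rooted forest with vertex set $V$ such that whenever $u$ is a child of $v$, $u<v$. A root is a vertex with no parent and a leaf is a vertex with no child (an isolated vertex is both a root and a leaf). -}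

module Defs where

open import Data.Bool using (Bool; true; false; _∧_; _∨_; not; if_then_else_)
open import Data.Nat as ℕ using (ℕ; zero; suc)
open import Data.Fin as Fin using (Fin; toℕ)
open import Data.List as List using (List; []; _∷_; map; concatMap; length; filterᵇ; allFin; cartesianProduct)
open import Data.Bool.ListAction using (all; any)
open import Data.Vec as Vec using (Vec; lookup)
open import Data.Maybe using (Maybe; just; nothing)
open import Data.Product using (_×_; _,_)
open import Data.Integer as ℤ using (ℤ; +_; _-_)
open import Relation.Nullary.Decidable using (⌊_⌋)

-- Conventions: [n] = {0,…,n-1} is indexed by Fin n (0-based); positions
-- are compared via toℕ.  A nonneg. integer vector a ∈ ℤ≥0^n is a : Vec ℕ n.

allVecs : {A : Set} → List A → (m : ℕ) → List (Vec A m)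
allVecs xs zero    = Vec.[] ∷ []
allVecs xs (suc m) = concatMap (λ x → map (x Vec.∷_) (allVecs xs m)) xs

bools : List Bool
bools = true ∷ false ∷ []

_⇒ᵇ_ : Bool → Bool → Bool
p ⇒ᵇ q = not p ∨ q

_<ᵇ_ : {n : ℕ} → Fin n → Fin n → Bool
i <ᵇ j = toℕ i ℕ.<ᵇ toℕ j

_≤ᵇ_ : {n : ℕ} → Fin n → Fin n → Bool
i ≤ᵇ j = toℕ i ℕ.≤ᵇ toℕ j

_=ᶠ_ : {n : ℕ} → Fin n → Fin n → Bool
i =ᶠ j = ⌊ i Fin.≟ j ⌋

∀ᶠ : (n : ℕ) → (Fin n → Bool) → Bool
∀ᶠ n p = all p (allFin n)

∃ᶠ : (n : ℕ) → (Fin n → Bool) → Bool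
∃ᶠ n p = any p (allFin n)

positive : ℕ → Bool
positive zero    = false
positive (suc _) = true

-- A filling is stored as an n×n 0/1 array (true = 1) whose entries strictly
-- below the diagonal (i > j) are required to be 0; so fillings of the shifted
-- staircase {(i,j) : i ≤ j} correspond exactly to such arrays.

Filling : ℕ → Set
Filling n = Vec (Vec Bool n) n

entry : {n : ℕ} → Filling n → Fin n → Fin n → Bool
entry T i j = lookup (lookup T i) j

isStaircase : {n : ℕ} → Filling n → Bool
isStaircase {n} T = ∀ᶠ n λ i → ∀ᶠ n λ j → (j <ᵇ i) ⇒ᵇ not (entry T i j)

rowNonzero : {n : ℕ} → Filling n → Fin n → Bool
rowNonzero {n} T i = ∃ᶠ n λ j → (i ≤ᵇ j) ∧ entry T i j

isTesler : {n : ℕ} → Vec ℕ n → Filling n → Bool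
isTesler {n} a T =
  isStaircase T
  -- (1)
  ∧ (∀ᶠ n λ i → positive (lookup a i) ⇒ᵇ rowNonzero T i)
  -- (2)
  ∧ (∀ᶠ n λ i → ∀ᶠ n λ j → ((i <ᵇ j) ∧ entry T i j) ⇒ᵇ rowNonzero T j)
  -- (3)
  ∧ (∀ᶠ n λ j →
       (not (positive (lookup a j))
        ∧ (∀ᶠ n λ i → (i <ᵇ j) ⇒ᵇ not (entry T i j)))
       ⇒ᵇ (∀ᶠ n λ k → (j ≤ᵇ k) ⇒ᵇ not (entry T j k)))

numOnes : {n : ℕ} → Filling n → ℕ
numOnes {n} T =
  length (filterᵇ (λ { (i , j) → (i ≤ᵇ j) ∧ entry T i j })
                  (cartesianProduct (allFin n) (allFin n)))

numNonzeroRows : {n : ℕ} → Filling n → ℕ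
numNonzeroRows {n} T = length (filterᵇ (rowNonzero T) (allFin n))

dimension : {n : ℕ} → Filling n → ℤ
dimension T = + numOnes T - + numNonzeroRows T

isDim0Tesler : {n : ℕ} → Vec ℕ n → Filling n → Bool
isDim0Tesler a T = isTesler a T ∧ ⌊ dimension T ℤ.≟ + 0 ⌋

allFillings : (n : ℕ) → List (Filling n)
allFillings n = allVecs (allVecs bools n) n

numDim0Tesler : {n : ℕ} → Vec ℕ n → ℕ
numDim0Tesler {n} a = length (filterᵇ (isDim0Tesler a) (allFillings n))

-- Pairs (V, F): V ⊆ [n] as a characteristic vector, F a rooted forest on V
-- given by its parent map (nothing = root).  A parent map on V in which every
-- parent is larger than its child is exactly a decreasing rooted forest on V
-- (acyclicity is automatic).

Subset : ℕ → Set
Subset n = Vec Bool n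

ParentMap : ℕ → Set
ParentMap n = Vec (Maybe (Fin n)) n

isChildOf : {n : ℕ} → ParentMap n → Fin n → Fin n → Bool
isChildOf p u v with lookup p u
... | nothing = false
... | just w  = w =ᶠ v

isDecreasingForestOn : {n : ℕ} → Subset n → ParentMap n → Bool
isDecreasingForestOn {n} V p = ∀ᶠ n λ v → check v (lookup p v)
  where
  check : Fin n → Maybe (Fin n) → Bool
  check v nothing  = true
  check v (just u) = lookup V v ∧ lookup V u ∧ (v <ᵇ u)

isLeaf : {n : ℕ} → Subset n → ParentMap n → Fin n → Bool
isLeaf {n} V p v = lookup V v ∧ not (∃ᶠ n λ u → lookup V u ∧ isChildOf p u v)

isGoodPair : {n : ℕ} → Vec ℕ n → Subset n × ParentMap n → Bool
isGoodPair {n} a (V , p) =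
  (∀ᶠ n λ v → positive (lookup a v) ⇒ᵇ lookup V v)
  ∧ isDecreasingForestOn V p
  ∧ (∀ᶠ n λ v → isLeaf V p v ⇒ᵇ positive (lookup a v))

allPairs : (n : ℕ) → List (Subset n × ParentMap n)
allPairs n = cartesianProduct (allVecs bools n)
                              (allVecs (nothing ∷ map just (allFin n)) n)

numGoodPairs : {n : ℕ} → Vec ℕ n → ℕ
numGoodPairs {n} a = length (filterᵇ (isGoodPair a) (allPairs n))

-- In a Tesler tableau every nonzero row contains a 1, so dimension 0 says that
-- every nonzero row contains exactly one 1.  Read a 1 in cell (i, j) with i < j
-- as "j is the parent of i" and a 1 on the diagonal as "i is a root": this is a
-- decreasing forest on the set V of nonzero rows.  Condition (1) says that the
-- support of a lies in V, condition (2) that parents lie in V, and condition (3)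
-- that a vertex of V outside the support has a child, i.e. that leaves lie in
-- the support.  Conversely, a good pair (V, F) gives the tableau with, in each
-- row i ∈ V, a single 1 in the column of the parent of i, or on the diagonal
-- when i is a root.

module Submission where

open import Defs
open import Data.Bool.ListAction using (any)
open import Data.Bool using (Bool; true; false; T; not; _∧_)
open import Data.Bool.Properties using (T-∧)
open import Data.Empty using (⊥-elim)
open import Data.Fin using (Fin; toℕ; _<_; _≤_)
open import Data.Fin.Properties using (any?; ¬∀⟶∃¬; toℕ-injective; _<?_)
open import Data.Integer using (+_)
import Data.Integer.Properties as ℤ
open import Data.List using (List; []; _∷_; map; length; filterᵇ; allFin; cartesianProduct; cartesianProductWith; concatMap; _++_)
import Data.List.Properties as List
open import Data.List.Membership.Propositional using (_∈_; lose)
open import Data.List.Membership.Propositional.Properties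
  using (∈-allFin; ∈-map⁺; ∈-map⁻; ∈-filter⁺; ∈-filter⁻; ∈-cartesianProduct⁺; ∈-cartesianProductWith⁺)
open import Data.List.Membership.Propositional.Properties.WithK using (unique∧set⇒bag)
open import Data.List.Relation.Binary.BagAndSetEquality using (∼bag⇒↭)
open import Data.List.Relation.Binary.Permutation.Propositional.Properties using (↭-length)
open import Data.List.Relation.Unary.All as All using (All; []; _∷_)
open import Data.List.Relation.Unary.All.Properties using (all⁺; all⁻; map⁺)
open import Data.List.Relation.Unary.AllPairs using ([]; _∷_)
open import Data.List.Relation.Unary.Any using (here; there; satisfied)
open import Data.List.Relation.Unary.Any.Properties using (any⁺; any⁻)
open import Data.List.Relation.Unary.Unique.Propositional using (Unique)
import Data.List.Relation.Unary.Unique.Propositional.Properties as Unique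
open import Data.Maybe using (Maybe; just; nothing; fromMaybe)
open import Data.Maybe.Properties using (just-injective)
open import Data.Nat as ℕ using (ℕ; zero; suc; _+_; z≤n; s≤s)
open import Data.Nat.ListAction using (sum)
import Data.Nat.Properties as ℕ
open import Data.Product using (_×_; _,_; proj₁; proj₂; ∃-syntax; uncurry)
open import Data.Sum using (inj₁; inj₂)
open import Data.Vec as Vec using (Vec; lookup; tabulate)
import Data.Vec.Properties as Vec
open import Function using (_∘_)
open import Function.Bundles using (_⇔_; mk⇔; Equivalence)
open import Relation.Binary.PropositionalEquality
open import Relation.Nullary using (¬_; yes; no)
open import Relation.Nullary.Decidable using (T?; _×-dec_; toWitness; fromWitness; decidable-stable)

open Equivalence using (to; from)

private
  variable
    A B : Set
    n : ℕ

-- Counting by a bijection between filtered enumerations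

record IsEnumeration {A : Set} (xs : List A) : Set where
  field
    unique   : Unique xs
    complete : ∀ x → x ∈ xs

open IsEnumeration

length-filterᵇ-bijection :
  {xs : List A} {ys : List B} {P : A → Bool} {Q : B → Bool} →
  IsEnumeration xs → IsEnumeration ys → (f : A → B) (g : B → A) →
  (∀ {x} → T (P x) → T (Q (f x))) → (∀ {y} → T (Q y) → T (P (g y))) →
  (∀ {x} → T (P x) → g (f x) ≡ x) → (∀ {y} → T (Q y) → f (g y) ≡ y) →
  length (filterᵇ P xs) ≡ length (filterᵇ Q ys)
length-filterᵇ-bijection {xs = xs} {ys} {P} {Q} exs eys f g PQ QP gf fg = begin
  length (filterᵇ P xs)          ≡⟨ List.length-map f (filterᵇ P xs) ⟨
  length (map f (filterᵇ P xs))  ≡⟨ ↭-length (∼bag⇒↭ (unique∧set⇒bag image-unique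
                                      (Unique.filter⁺ (T? ∘ Q) (unique eys)) (mk⇔ into onto))) ⟩
  length (filterᵇ Q ys)          ∎
  where
  open ≡-Reasoning

  g∘f≡id : map g (map f (filterᵇ P xs)) ≡ filterᵇ P xs
  g∘f≡id = trans (sym (List.map-∘ (filterᵇ P xs)))
    (List.map-id-local (All.tabulate (gf ∘ proj₂ ∘ ∈-filter⁻ (T? ∘ P) {xs = xs})))

  image-unique : Unique (map f (filterᵇ P xs))
  image-unique = Unique.map⁻ (subst Unique (sym g∘f≡id) (Unique.filter⁺ (T? ∘ P) (unique exs)))

  into : ∀ {y} → y ∈ map f (filterᵇ P xs) → y ∈ filterᵇ Q ys
  into y∈ with ∈-map⁻ f y∈
  ... | x , x∈ , refl =
    ∈-filter⁺ (T? ∘ Q) (complete eys (f x)) (PQ (proj₂ (∈-filter⁻ (T? ∘ P) {xs = xs} x∈)))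

  onto : ∀ {y} → y ∈ filterᵇ Q ys → y ∈ map f (filterᵇ P xs)
  onto {y} y∈ = let Qy = proj₂ (∈-filter⁻ (T? ∘ Q) {xs = ys} y∈) in
    subst (_∈ map f (filterᵇ P xs)) (fg Qy) (∈-map⁺ f (∈-filter⁺ (T? ∘ P) (complete exs (g y)) (QP Qy)))

bools-isEnumeration : IsEnumeration bools
bools-isEnumeration = record
  { unique   = ((λ ()) ∷ []) ∷ [] ∷ []
  ; complete = λ { true → here refl ; false → there (here refl) }
  }

allFin-isEnumeration : IsEnumeration (allFin n)
allFin-isEnumeration {n} = record { unique = Unique.allFin⁺ n ; complete = ∈-allFin }

maybe-isEnumeration : {xs : List A} → IsEnumeration xs → IsEnumeration (nothing ∷ map just xs)
maybe-isEnumeration exs = record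
  { unique   = map⁺ (All.tabulate λ _ ()) ∷ Unique.map⁺ just-injective (unique exs)
  ; complete = λ { nothing → here refl ; (just x) → there (∈-map⁺ just (complete exs x)) }
  }

cartesianProduct-isEnumeration : {xs : List A} {ys : List B} →
  IsEnumeration xs → IsEnumeration ys → IsEnumeration (cartesianProduct xs ys)
cartesianProduct-isEnumeration exs eys = record
  { unique   = Unique.cartesianProduct⁺ (unique exs) (unique eys)
  ; complete = λ (x , y) → ∈-cartesianProduct⁺ (complete exs x) (complete eys y)
  }

allVecs-suc : (xs : List A) (m : ℕ) →
  allVecs xs (suc m) ≡ cartesianProductWith Vec._∷_ xs (allVecs xs m)
allVecs-suc xs m = go xs
  where
  go : ∀ ys → concatMap (λ y → map (y Vec.∷_) (allVecs xs m)) ys ≡ cartesianProductWith Vec._∷_ ys (allVecs xs m)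
  go []       = refl
  go (y ∷ ys) = cong (map (y Vec.∷_) (allVecs xs m) ++_) (go ys)

allVecs-isEnumeration : {xs : List A} → IsEnumeration xs → ∀ m → IsEnumeration (allVecs xs m)
allVecs-isEnumeration exs zero = record
  { unique = [] ∷ [] ; complete = λ { Vec.[] → here refl } }
allVecs-isEnumeration {xs = xs} exs (suc m) = subst IsEnumeration (sym (allVecs-suc xs m)) (record
  { unique   = Unique.cartesianProductWith⁺ Vec._∷_ Vec.∷-injective (unique exs) (unique rec)
  ; complete = λ { (x Vec.∷ v) → ∈-cartesianProductWith⁺ Vec._∷_ (complete exs x) (complete rec v) }
  })
  where
  rec : IsEnumeration (allVecs xs m)
  rec = allVecs-isEnumeration exs m

allFillings-isEnumeration : IsEnumeration (allFillings n)
allFillings-isEnumeration {n} = allVecs-isEnumeration (allVecs-isEnumeration bools-isEnumeration n) n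

allPairs-isEnumeration : IsEnumeration (allPairs n)
allPairs-isEnumeration {n} = cartesianProduct-isEnumeration
  (allVecs-isEnumeration bools-isEnumeration n)
  (allVecs-isEnumeration (maybe-isEnumeration allFin-isEnumeration) n)

indicator : Bool → ℕ
indicator false = 0
indicator true  = 1

length-filterᵇ≡sum-indicator : (q : A → Bool) (xs : List A) →
  length (filterᵇ q xs) ≡ sum (map (indicator ∘ q) xs)
length-filterᵇ≡sum-indicator q []       = refl
length-filterᵇ≡sum-indicator q (x ∷ xs) with q x
... | true  = cong suc (length-filterᵇ≡sum-indicator q xs)
... | false = length-filterᵇ≡sum-indicator q xs

length-filterᵇ-cartesianProduct : (h : A × B → Bool) (xs : List A) (ys : List B) →
  length (filterᵇ h (cartesianProduct xs ys)) ≡ sum (map (λ x → length (filterᵇ (λ y → h (x , y)) ys)) xs)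
length-filterᵇ-cartesianProduct h []       ys = refl
length-filterᵇ-cartesianProduct h (x ∷ xs) ys = begin
  length (filterᵇ h (map (x ,_) ys ++ cartesianProduct xs ys))
    ≡⟨ cong length (List.filter-++ (T? ∘ h) (map (x ,_) ys) (cartesianProduct xs ys)) ⟩
  length (filterᵇ h (map (x ,_) ys) ++ filterᵇ h (cartesianProduct xs ys))
    ≡⟨ List.length-++ (filterᵇ h (map (x ,_) ys)) ⟩
  length (filterᵇ h (map (x ,_) ys)) + length (filterᵇ h (cartesianProduct xs ys))
    ≡⟨ cong₂ _+_ row (length-filterᵇ-cartesianProduct h xs ys) ⟩
  length (filterᵇ (λ y → h (x , y)) ys) + sum (map (λ x → length (filterᵇ (λ y → h (x , y)) ys)) xs) ∎
  where
  open ≡-Reasoning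
  row : length (filterᵇ h (map (x ,_) ys)) ≡ length (filterᵇ (λ y → h (x , y)) ys)
  row = begin
    length (filterᵇ h (map (x ,_) ys))            ≡⟨ length-filterᵇ≡sum-indicator h (map (x ,_) ys) ⟩
    sum (map (indicator ∘ h) (map (x ,_) ys))     ≡⟨ cong sum (List.map-∘ ys) ⟨
    sum (map (λ y → indicator (h (x , y))) ys)    ≡⟨ length-filterᵇ≡sum-indicator (λ y → h (x , y)) ys ⟨
    length (filterᵇ (λ y → h (x , y)) ys)         ∎

indicator-any≤length-filterᵇ : (q : A → Bool) (xs : List A) →
  indicator (any q xs) ℕ.≤ length (filterᵇ q xs)
indicator-any≤length-filterᵇ q []       = z≤n
indicator-any≤length-filterᵇ q (x ∷ xs) with q x
... | true  = s≤s z≤n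
... | false = indicator-any≤length-filterᵇ q xs

length-filterᵇ≡indicator-any : (q : A → Bool) {xs : List A} → Unique xs →
  (∀ {x y} → T (q x) → T (q y) → x ≡ y) → length (filterᵇ q xs) ≡ indicator (any q xs)
length-filterᵇ≡indicator-any q []               single = refl
length-filterᵇ≡indicator-any q {x ∷ xs} (x∉xs ∷ u) single with q x in qx
... | true  = cong (suc ∘ length) (List.filter-none (T? ∘ q)
                (All.map (λ x≢y qy → x≢y (single (subst T (sym qx) _) qy)) x∉xs))
... | false = length-filterᵇ≡indicator-any q u single

length-filterᵇ≤1⇒≡ : (q : A → Bool) (xs : List A) → length (filterᵇ q xs) ℕ.≤ 1 →
  ∀ {x y} → x ∈ xs → y ∈ xs → T (q x) → T (q y) → x ≡ y
length-filterᵇ≤1⇒≡ q xs ≤1 x∈ y∈ qx qy =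
  singleton ≤1 (∈-filter⁺ (T? ∘ q) x∈ qx) (∈-filter⁺ (T? ∘ q) y∈ qy)
  where
  singleton : ∀ {zs : List _} {x y} → length zs ℕ.≤ 1 → x ∈ zs → y ∈ zs → x ≡ y
  singleton {_ ∷ []}    _         (here refl) (here refl) = refl
  singleton {_ ∷ _ ∷ _} (s≤s ())

+-≡⇒≡ˡ : ∀ {a b c d} → a ℕ.≤ c → b ℕ.≤ d → a + b ≡ c + d → a ≡ c
+-≡⇒≡ˡ {a} {b} {c} {d} a≤c b≤d eq = ℕ.≤-antisym a≤c (ℕ.+-cancelʳ-≤ b c a (begin
  c + b ≤⟨ ℕ.+-monoʳ-≤ c b≤d ⟩
  c + d ≡⟨ eq ⟨
  a + b ∎))
  where open ℕ.≤-Reasoning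

sum-map-mono : (f g : A → ℕ) → (∀ x → f x ℕ.≤ g x) → ∀ xs → sum (map f xs) ℕ.≤ sum (map g xs)
sum-map-mono f g f≤g []       = z≤n
sum-map-mono f g f≤g (x ∷ xs) = ℕ.+-mono-≤ (f≤g x) (sum-map-mono f g f≤g xs)

sum-map-≡⇒≡ : (f g : A → ℕ) → (∀ x → f x ℕ.≤ g x) → ∀ {xs} →
  sum (map f xs) ≡ sum (map g xs) → ∀ {x} → x ∈ xs → f x ≡ g x
sum-map-≡⇒≡ f g f≤g {y ∷ ys} eq x∈ with +-≡⇒≡ˡ (f≤g y) (sum-map-mono f g f≤g ys) eq
sum-map-≡⇒≡ f g f≤g {y ∷ ys} eq (here refl) | fy≡gy = fy≡gy
sum-map-≡⇒≡ f g f≤g {y ∷ ys} eq (there x∈) | fy≡gy =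
  sum-map-≡⇒≡ f g f≤g (ℕ.+-cancelˡ-≡ (f y) _ _ (trans eq (cong (_+ sum (map g ys)) (sym fy≡gy)))) x∈

-- Reading the Boolean definitions as propositions

T-injective : ∀ {x y} → (T x ⇔ T y) → x ≡ y
T-injective {false} {false} _   = refl
T-injective {false} {true}  x⇔y = ⊥-elim (from x⇔y _)
T-injective {true}  {false} x⇔y = ⊥-elim (to x⇔y _)
T-injective {true}  {true}  _   = refl

T-not : ∀ {x} → T (not x) ⇔ (¬ T x)
T-not {false} = mk⇔ (λ _ ()) _
T-not {true}  = mk⇔ (λ ()) (λ ¬⊤ → ¬⊤ _)

T-⇒ᵇ : ∀ {x y} → T (x ⇒ᵇ y) ⇔ (T x → T y)
T-⇒ᵇ {false} = mk⇔ (λ _ ()) _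
T-⇒ᵇ {true}  = mk⇔ (λ y _ → y) (λ f → f _)

T-<ᵇ : {i j : Fin n} → T (i <ᵇ j) ⇔ i < j
T-<ᵇ {i = i} {j} = mk⇔ (ℕ.<ᵇ⇒< (toℕ i) (toℕ j)) ℕ.<⇒<ᵇ

T-≤ᵇ : {i j : Fin n} → T (i ≤ᵇ j) ⇔ i ≤ j
T-≤ᵇ {i = i} {j} = mk⇔ (ℕ.≤ᵇ⇒≤ (toℕ i) (toℕ j)) ℕ.≤⇒≤ᵇ

T-=ᶠ : {i j : Fin n} → T (i =ᶠ j) ⇔ i ≡ j
T-=ᶠ = mk⇔ toWitness fromWitness

T-∀ᶠ : {p : Fin n → Bool} → T (∀ᶠ n p) ⇔ (∀ i → T (p i))
T-∀ᶠ {n} {p} = mk⇔ (λ h i → All.lookup (all⁺ p (allFin n) h) (∈-allFin i))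
                   (λ f → all⁻ p {allFin n} (All.tabulate λ {i} _ → f i))

T-∃ᶠ : {p : Fin n → Bool} → T (∃ᶠ n p) ⇔ (∃[ i ] T (p i))
T-∃ᶠ {n} {p} = mk⇔ (λ h → satisfied (any⁻ p (allFin n) h))
                   (λ (i , pi) → any⁺ p (lose (∈-allFin i) pi))

∀ᶠ-counterexample : {p : Fin n → Bool} → ¬ T (∀ᶠ n p) → ∃[ i ] ¬ T (p i)
∀ᶠ-counterexample {n} {p} ¬all = ¬∀⟶∃¬ n (T ∘ p) (T? ∘ p) (¬all ∘ from T-∀ᶠ)

T-rowNonzero : (t : Filling n) (i : Fin n) → T (rowNonzero t i) ⇔ (∃[ j ] i ≤ j × T (entry t i j))
T-rowNonzero t i = mk⇔
  (λ h → let j , i≤j∧1 = to T-∃ᶠ h ; i≤j , 1ᵢⱼ = to T-∧ i≤j∧1 in j , to T-≤ᵇ i≤j , 1ᵢⱼ)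
  (λ (j , i≤j , 1ᵢⱼ) → from T-∃ᶠ (j , from T-∧ (from T-≤ᵇ i≤j , 1ᵢⱼ)))

T-isChildOf : {p : ParentMap n} {u v : Fin n} → T (isChildOf p u v) ⇔ lookup p u ≡ just v
T-isChildOf {p = p} {u} {v} with lookup p u
... | nothing = mk⇔ (λ ()) (λ ())
... | just w  = mk⇔ (cong just ∘ to T-=ᶠ) (from T-=ᶠ ∘ just-injective)

record IsTesler (a : Vec ℕ n) (t : Filling n) : Set where
  field
    staircase        : ∀ {i j} → T (entry t i j) → i ≤ j
    positive⇒nonzero : ∀ {i} → T (positive (lookup a i)) → T (rowNonzero t i)
    column⇒nonzero   : ∀ {i j} → i < j → T (entry t i j) → T (rowNonzero t j)
    emptyColumn⇒zero : ∀ {j} → ¬ T (positive (lookup a j)) →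
                       (∀ {i} → i < j → ¬ T (entry t i j)) → ¬ T (rowNonzero t j)

T-isStaircase : {t : Filling n} → T (isStaircase t) ⇔ (∀ {i j} → T (entry t i j) → i ≤ j)
T-isStaircase = mk⇔
  (λ h {i} {j} 1ᵢⱼ → ℕ.≮⇒≥ λ j<i → to T-not (to T-⇒ᵇ (to T-∀ᶠ (to T-∀ᶠ h i) j) (from T-<ᵇ j<i)) 1ᵢⱼ)
  (λ f → from T-∀ᶠ λ i → from T-∀ᶠ λ j → from T-⇒ᵇ λ j<i → from T-not λ 1ᵢⱼ → ℕ.<⇒≱ (to T-<ᵇ j<i) (f {i} {j} 1ᵢⱼ))

T-isTesler : {a : Vec ℕ n} {t : Filling n} → T (isTesler a t) ⇔ IsTesler a t
T-isTesler {n} {a} {t} = mk⇔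
  (λ h → let s , c₁ , c₂ , c₃ = split h in record
    { staircase        = to (T-isStaircase {t = t}) s
    ; positive⇒nonzero = to T-C₁ c₁
    ; column⇒nonzero   = to T-C₂ c₂
    ; emptyColumn⇒zero = to T-C₃ c₃
    })
  (λ τ → let open IsTesler τ in
    from (T-∧ {isStaircase t}) (from (T-isStaircase {t = t}) staircase ,
      from (T-∧ {C₁}) (from T-C₁ positive⇒nonzero ,
        from (T-∧ {C₂}) (from T-C₂ column⇒nonzero , from T-C₃ emptyColumn⇒zero))))
  where
  C₁ C₂ C₃ : Bool
  C₁ = ∀ᶠ n λ i → positive (lookup a i) ⇒ᵇ rowNonzero t i
  C₂ = ∀ᶠ n λ i → ∀ᶠ n λ j → ((i <ᵇ j) ∧ entry t i j) ⇒ᵇ rowNonzero t j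
  C₃ = ∀ᶠ n λ j → (not (positive (lookup a j)) ∧ (∀ᶠ n λ i → (i <ᵇ j) ⇒ᵇ not (entry t i j)))
                   ⇒ᵇ (∀ᶠ n λ k → (j ≤ᵇ k) ⇒ᵇ not (entry t j k))

  split : T (isTesler a t) → T (isStaircase t) × T C₁ × T C₂ × T C₃
  split h = let s , h′ = to (T-∧ {isStaircase t}) h
                c₁ , h″ = to (T-∧ {C₁}) h′
                c₂ , c₃ = to (T-∧ {C₂}) h″
            in s , c₁ , c₂ , c₃

  T-C₁ : T C₁ ⇔ (∀ {i} → T (positive (lookup a i)) → T (rowNonzero t i))
  T-C₁ = mk⇔ (λ c {i} → to T-⇒ᵇ (to T-∀ᶠ c i)) (λ f → from T-∀ᶠ λ i → from T-⇒ᵇ (f {i}))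

  T-C₂ : T C₂ ⇔ (∀ {i j} → i < j → T (entry t i j) → T (rowNonzero t j))
  T-C₂ = mk⇔
    (λ c {i} {j} i<j 1ᵢⱼ → to T-⇒ᵇ (to T-∀ᶠ (to T-∀ᶠ c i) j) (from (T-∧ {i <ᵇ j}) (from T-<ᵇ i<j , 1ᵢⱼ)))
    (λ f → from T-∀ᶠ λ i → from T-∀ᶠ λ j → from T-⇒ᵇ λ i<j∧1 →
       let i<j , 1ᵢⱼ = to (T-∧ {i <ᵇ j}) i<j∧1 in f (to (T-<ᵇ {i = i}) i<j) 1ᵢⱼ)

  ZeroRow EmptyColumn : Fin n → Bool
  ZeroRow j = ∀ᶠ n λ k → (j ≤ᵇ k) ⇒ᵇ not (entry t j k)
  EmptyColumn j = ∀ᶠ n λ i → (i <ᵇ j) ⇒ᵇ not (entry t i j)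

  T-ZeroRow : ∀ {j} → T (ZeroRow j) ⇔ (¬ T (rowNonzero t j))
  T-ZeroRow {j} = mk⇔
    (λ z nz → let k , j≤k , 1ⱼₖ = to (T-rowNonzero t j) nz in
       to T-not (to T-⇒ᵇ (to T-∀ᶠ z k) (from (T-≤ᵇ {i = j}) j≤k)) 1ⱼₖ)
    (λ ¬nz → from T-∀ᶠ λ k → from T-⇒ᵇ λ j≤k → from T-not λ 1ⱼₖ →
       ¬nz (from (T-rowNonzero t j) (k , to (T-≤ᵇ {i = j}) j≤k , 1ⱼₖ)))

  T-EmptyColumn : ∀ {j} → T (EmptyColumn j) ⇔ (∀ {i} → i < j → ¬ T (entry t i j))
  T-EmptyColumn {j} = mk⇔
    (λ e {i} i<j → to T-not (to T-⇒ᵇ (to T-∀ᶠ e i) (from (T-<ᵇ {i = i}) i<j)))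
    (λ f → from T-∀ᶠ λ i → from T-⇒ᵇ λ i<j → from T-not (f (to (T-<ᵇ {i = i}) i<j)))

  T-C₃ : T C₃ ⇔ (∀ {j} → ¬ T (positive (lookup a j)) → (∀ {i} → i < j → ¬ T (entry t i j)) → ¬ T (rowNonzero t j))
  T-C₃ = mk⇔
    (λ c {j} ¬pos empty → to T-ZeroRow (to T-⇒ᵇ (to T-∀ᶠ c j)
       (from (T-∧ {not (positive (lookup a j))} {EmptyColumn j}) (from T-not ¬pos , from (T-EmptyColumn {j}) (λ {i} → empty {i})))))
    (λ f → from T-∀ᶠ λ j → from T-⇒ᵇ λ ¬pos∧empty →
       let ¬pos , empty = to (T-∧ {not (positive (lookup a j))}) ¬pos∧empty in
       from T-ZeroRow (f (to T-not ¬pos) (to T-EmptyColumn empty)))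

record IsDecreasingForest (V : Subset n) (p : ParentMap n) : Set where
  field
    child∈V      : ∀ {v u} → lookup p v ≡ just u → T (lookup V v)
    parent∈V     : ∀ {v u} → lookup p v ≡ just u → T (lookup V u)
    child<parent : ∀ {v u} → lookup p v ≡ just u → v < u

T-isDecreasingForestOn : {V : Subset n} {p : ParentMap n} →
  T (isDecreasingForestOn V p) ⇔ IsDecreasingForest V p
T-isDecreasingForestOn {n} {V} {p} = mk⇔
  (λ h → record
    { child∈V      = proj₁ ∘ edge h
    ; parent∈V     = proj₁ ∘ proj₂ ∘ edge h
    ; child<parent = proj₂ ∘ proj₂ ∘ edge h
    })
  encode
  where
  edge : T (isDecreasingForestOn V p) → ∀ {v u} → lookup p v ≡ just u →
         T (lookup V v) × T (lookup V u) × v < u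
  edge h {v} e with lookup p v | to T-∀ᶠ h v
  edge h {v} refl | just u | ok =
    let v∈V , u∈V∧v<u = to (T-∧ {lookup V v}) ok
        u∈V , v<u     = to (T-∧ {lookup V u}) u∈V∧v<u
    in v∈V , u∈V , to (T-<ᵇ {i = v}) v<u

  -- The per-vertex test inside isDecreasingForestOn is a where-bound function
  -- that cannot be named here; it is reached through a failing vertex instead.
  encode : IsDecreasingForest V p → T (isDecreasingForestOn V p)
  encode F with T? (isDecreasingForestOn V p)
  ... | yes h = h
  ... | no ¬h with ∀ᶠ-counterexample ¬h
  ... | v , ¬ok with lookup p v in e | ¬ok
  ... | nothing | ¬ok′ = ⊥-elim (¬ok′ _)
  ... | just u  | ¬ok′ = ⊥-elim (¬ok′ (from T-∧ (child∈V e , from T-∧ (parent∈V e , from T-<ᵇ (child<parent e)))))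
    where open IsDecreasingForest F

record IsGoodPair (a : Vec ℕ n) (V : Subset n) (p : ParentMap n) : Set where
  field
    positive∈V      : ∀ {v} → T (positive (lookup a v)) → T (lookup V v)
    forest          : IsDecreasingForest V p
    nonpositive⇒child : ∀ {v} → T (lookup V v) → ¬ T (positive (lookup a v)) → ∃[ u ] lookup p u ≡ just v

T-isGoodPair : {a : Vec ℕ n} {V : Subset n} {p : ParentMap n} →
  T (isGoodPair a (V , p)) ⇔ IsGoodPair a V p
T-isGoodPair {n} {a} {V} {p} = mk⇔
  (λ h → let g₁ , f , g₃ = split h in record
    { positive∈V        = to T-G₁ g₁
    ; forest            = to T-isDecreasingForestOn f
    ; nonpositive⇒child = G₃⇒child g₃
    })
  (λ γ → let open IsGoodPair γ in
    from (T-∧ {G₁}) (from T-G₁ positive∈V ,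
      from (T-∧ {isDecreasingForestOn V p}) (from T-isDecreasingForestOn forest ,
        child⇒G₃ (IsDecreasingForest.child∈V forest) nonpositive⇒child)))
  where
  G₁ G₃ : Bool
  G₁ = ∀ᶠ n λ v → positive (lookup a v) ⇒ᵇ lookup V v
  G₃ = ∀ᶠ n λ v → isLeaf V p v ⇒ᵇ positive (lookup a v)

  split : T (isGoodPair a (V , p)) → T G₁ × T (isDecreasingForestOn V p) × T G₃
  split h = let g₁ , h′ = to (T-∧ {G₁}) h
                f , g₃  = to (T-∧ {isDecreasingForestOn V p}) h′
            in g₁ , f , g₃

  T-G₁ : T G₁ ⇔ (∀ {v} → T (positive (lookup a v)) → T (lookup V v))
  T-G₁ = mk⇔ (λ g {v} → to T-⇒ᵇ (to T-∀ᶠ g v)) (λ f → from T-∀ᶠ λ v → from T-⇒ᵇ (f {v}))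

  HasChild : Fin n → Bool
  HasChild v = ∃ᶠ n λ u → lookup V u ∧ isChildOf p u v

  G₃⇒hasChild : T G₃ → ∀ {v} → T (lookup V v) → ¬ T (positive (lookup a v)) → T (HasChild v)
  G₃⇒hasChild g {v} v∈V ¬pos = decidable-stable (T? (HasChild v)) λ ¬child →
    ¬pos (to T-⇒ᵇ (to T-∀ᶠ g v) (from (T-∧ {lookup V v}) (v∈V , from T-not ¬child)))

  G₃⇒child : T G₃ → ∀ {v} → T (lookup V v) → ¬ T (positive (lookup a v)) → ∃[ u ] lookup p u ≡ just v
  G₃⇒child g v∈V ¬pos with to (T-∃ᶠ {n}) (G₃⇒hasChild g v∈V ¬pos)
  ... | u , u∈V∧child = u , to (T-isChildOf {p = p}) (proj₂ (to (T-∧ {lookup V u}) u∈V∧child))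

  child⇒G₃ : (∀ {v u} → lookup p v ≡ just u → T (lookup V v)) →
             (∀ {v} → T (lookup V v) → ¬ T (positive (lookup a v)) → ∃[ u ] lookup p u ≡ just v) → T G₃
  child⇒G₃ child∈V has-child = from T-∀ᶠ λ v → from T-⇒ᵇ λ leaf →
    let v∈V , ¬child = to (T-∧ {lookup V v}) leaf in
    decidable-stable (T? _) λ ¬pos → let u , e = has-child v∈V ¬pos in
      to T-not ¬child (from (T-∃ᶠ {n}) (u , from (T-∧ {lookup V u}) (child∈V e , from (T-isChildOf {p = p}) e)))

-- Dimension zero means at most one 1 per row

RowFunctional : Filling n → Set
RowFunctional t = ∀ {i j k} → i ≤ j → i ≤ k → T (entry t i j) → T (entry t i k) → j ≡ k

rowCell : Filling n → Fin n → Fin n → Bool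
rowCell t i j = (i ≤ᵇ j) ∧ entry t i j

rowCount : Filling n → Fin n → ℕ
rowCount {n} t i = length (filterᵇ (rowCell t i) (allFin n))

numOnes≡sum-rowCount : (t : Filling n) → numOnes t ≡ sum (map (rowCount t) (allFin n))
numOnes≡sum-rowCount {n} t = length-filterᵇ-cartesianProduct _ (allFin n) (allFin n)

numNonzeroRows≡sum-indicator : (t : Filling n) →
  numNonzeroRows t ≡ sum (map (indicator ∘ rowNonzero t) (allFin n))
numNonzeroRows≡sum-indicator {n} t = length-filterᵇ≡sum-indicator (rowNonzero t) (allFin n)

numOnes≡numNonzeroRows⇒rowFunctional : (t : Filling n) →
  numOnes t ≡ numNonzeroRows t → RowFunctional t
numOnes≡numNonzeroRows⇒rowFunctional {n} t eq {i} i≤j i≤k 1ᵢⱼ 1ᵢₖ =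
  length-filterᵇ≤1⇒≡ (rowCell t i) (allFin n) count≤1 (∈-allFin _) (∈-allFin _)
    (from T-∧ (from T-≤ᵇ i≤j , 1ᵢⱼ)) (from T-∧ (from T-≤ᵇ i≤k , 1ᵢₖ))
  where
  nonzero≤count : ∀ i → indicator (rowNonzero t i) ℕ.≤ rowCount t i
  nonzero≤count i = indicator-any≤length-filterᵇ (rowCell t i) (allFin n)
  sums : sum (map (indicator ∘ rowNonzero t) (allFin n)) ≡ sum (map (rowCount t) (allFin n))
  sums = trans (sym (numNonzeroRows≡sum-indicator t)) (trans (sym eq) (numOnes≡sum-rowCount t))
  count≤1 : rowCount t i ℕ.≤ 1
  count≤1 = subst (ℕ._≤ 1) (sum-map-≡⇒≡ _ _ nonzero≤count sums (∈-allFin i)) (indicator≤1 (rowNonzero t i))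
    where
    indicator≤1 : ∀ b → indicator b ℕ.≤ 1
    indicator≤1 false = z≤n
    indicator≤1 true  = s≤s z≤n

rowFunctional⇒numOnes≡numNonzeroRows : (t : Filling n) →
  RowFunctional t → numOnes t ≡ numNonzeroRows t
rowFunctional⇒numOnes≡numNonzeroRows {n} t f = begin
  numOnes t                                        ≡⟨ numOnes≡sum-rowCount t ⟩
  sum (map (rowCount t) (allFin n))                ≡⟨ cong sum (List.map-cong count≡indicator (allFin n)) ⟩
  sum (map (indicator ∘ rowNonzero t) (allFin n))  ≡⟨ numNonzeroRows≡sum-indicator t ⟨
  numNonzeroRows t                                 ∎
  where
  open ≡-Reasoning
  count≡indicator : ∀ i → rowCount t i ≡ indicator (rowNonzero t i)
  count≡indicator i = length-filterᵇ≡indicator-any (rowCell t i) (Unique.allFin⁺ n) λ cᵢⱼ cᵢₖ →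
    let i≤j , 1ᵢⱼ = to (T-∧ {i ≤ᵇ _}) cᵢⱼ ; i≤k , 1ᵢₖ = to (T-∧ {i ≤ᵇ _}) cᵢₖ in
    f (to T-≤ᵇ i≤j) (to T-≤ᵇ i≤k) 1ᵢⱼ 1ᵢₖ

dimension≡0⇔ : {t : Filling n} → dimension t ≡ + 0 ⇔ numOnes t ≡ numNonzeroRows t
dimension≡0⇔ = mk⇔ (ℤ.+-injective ∘ ℤ.i-j≡0⇒i≡j _ _) (ℤ.i≡j⇒i-j≡0 ∘ cong (+_))

T-isDim0Tesler : {a : Vec ℕ n} {t : Filling n} → T (isDim0Tesler a t) ⇔ (IsTesler a t × RowFunctional t)
T-isDim0Tesler {a = a} {t} = mk⇔ decode encode
  where
  decode : T (isDim0Tesler a t) → IsTesler a t × RowFunctional t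
  decode h = let τ , d = to (T-∧ {isTesler a t}) h in
    to T-isTesler τ , numOnes≡numNonzeroRows⇒rowFunctional t (to (dimension≡0⇔ {t = t}) (toWitness d))

  encode : IsTesler a t × RowFunctional t → T (isDim0Tesler a t)
  encode (τ , f) = from (T-∧ {isTesler a t})
    (from T-isTesler τ , fromWitness (from (dimension≡0⇔ {t = t}) (rowFunctional⇒numOnes≡numNonzeroRows t f)))

-- The bijection

column : ParentMap n → Fin n → Fin n
column p i = fromMaybe i (lookup p i)

tableau : Subset n × ParentMap n → Filling n
tableau (V , p) = tabulate λ i → tabulate λ j → lookup V i ∧ (j =ᶠ column p i)

parentOf : Filling n → Fin n → Maybe (Fin n)
parentOf t i with any? (λ j → i <? j ×-dec T? (entry t i j))
... | yes (j , _) = just j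
... | no _        = nothing

forestOf : Filling n → Subset n × ParentMap n
forestOf t = tabulate (rowNonzero t) , tabulate (parentOf t)

tabulate-≗lookup : {f : Fin n → A} {v : Vec A n} → (∀ i → f i ≡ lookup v i) → tabulate f ≡ v
tabulate-≗lookup {v = v} f≗v = trans (Vec.tabulate-cong f≗v) (Vec.tabulate∘lookup v)

entry-tableau : (V : Subset n) (p : ParentMap n) (i j : Fin n) →
  T (entry (tableau (V , p)) i j) ⇔ (T (lookup V i) × j ≡ column p i)
entry-tableau V p i j = subst (λ b → T b ⇔ (T (lookup V i) × j ≡ column p i)) (sym entry≡) (mk⇔
  (λ 1ᵢⱼ → let i∈V , j=col = to (T-∧ {lookup V i}) 1ᵢⱼ in i∈V , to T-=ᶠ j=col)
  (λ (i∈V , j≡col) → from (T-∧ {lookup V i}) (i∈V , from T-=ᶠ j≡col)))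
  where
  entry≡ : entry (tableau (V , p)) i j ≡ lookup V i ∧ (j =ᶠ column p i)
  entry≡ = trans (cong (λ row → lookup row j) (Vec.lookup∘tabulate _ i)) (Vec.lookup∘tabulate _ j)

parentOf-just : {t : Filling n} {i u : Fin n} → parentOf t i ≡ just u → i < u × T (entry t i u)
parentOf-just {t = t} {i} e with any? (λ j → i <? j ×-dec T? (entry t i j))
parentOf-just refl | yes (_ , i<u , 1ᵢᵤ) = i<u , 1ᵢᵤ

parentOf-nothing : {t : Filling n} {i j : Fin n} → parentOf t i ≡ nothing → i < j → ¬ T (entry t i j)
parentOf-nothing {t = t} {i} {j} e i<j 1ᵢⱼ with any? (λ j → i <? j ×-dec T? (entry t i j))
parentOf-nothing () i<j 1ᵢⱼ | yes _
parentOf-nothing e i<j 1ᵢⱼ  | no none = none (_ , i<j , 1ᵢⱼ)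

parentOf-unique : {t : Filling n} {i u : Fin n} → i < u → T (entry t i u) →
  (∀ {k} → i < k → T (entry t i k) → k ≡ u) → parentOf t i ≡ just u
parentOf-unique {t = t} {i} i<u 1ᵢᵤ unique with parentOf t i in e
... | just k  = cong just (unique (proj₁ (parentOf-just e)) (proj₂ (parentOf-just e)))
... | nothing = ⊥-elim (parentOf-nothing e i<u 1ᵢᵤ)

parentOf-none : {t : Filling n} {i : Fin n} → (∀ {k} → i < k → ¬ T (entry t i k)) → parentOf t i ≡ nothing
parentOf-none {t = t} {i} none with parentOf t i in e
... | just k  = ⊥-elim (none (proj₁ (parentOf-just e)) (proj₂ (parentOf-just e)))
... | nothing = refl

column-parent : {p : ParentMap n} {i j : Fin n} → j ≡ column p i → i < j → lookup p i ≡ just j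
column-parent {p = p} {i} j≡col i<j with lookup p i
... | nothing = ⊥-elim (ℕ.<-irrefl (cong toℕ (sym j≡col)) i<j)
... | just u  = cong just (sym j≡col)

tableau-rowFunctional : (V : Subset n) (p : ParentMap n) → RowFunctional (tableau (V , p))
tableau-rowFunctional V p {i} {j} {k} _ _ 1ᵢⱼ 1ᵢₖ =
  trans (proj₂ (to (entry-tableau V p i j) 1ᵢⱼ)) (sym (proj₂ (to (entry-tableau V p i k) 1ᵢₖ)))

module _ {V : Subset n} {p : ParentMap n} (F : IsDecreasingForest V p) where
  open IsDecreasingForest F

  i≤column : ∀ i → i ≤ column p i
  i≤column i with lookup p i in e
  ... | nothing = ℕ.≤-refl
  ... | just u  = ℕ.<⇒≤ (child<parent e)

  rowNonzero-tableau : ∀ i → rowNonzero (tableau (V , p)) i ≡ lookup V i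
  rowNonzero-tableau i = T-injective (mk⇔
    (λ nz → let j , _ , 1ᵢⱼ = to (T-rowNonzero (tableau (V , p)) i) nz in proj₁ (to (entry-tableau V p i j) 1ᵢⱼ))
    (λ i∈V → from (T-rowNonzero (tableau (V , p)) i)
      (column p i , i≤column i , from (entry-tableau V p i (column p i)) (i∈V , refl))))

  parentOf-tableau : ∀ i → parentOf (tableau (V , p)) i ≡ lookup p i
  parentOf-tableau i with lookup p i in e
  ... | just u  = parentOf-unique (child<parent e)
        (from (entry-tableau V p i u) (child∈V e , sym (cong (fromMaybe i) e)))
        (λ _ 1ᵢₖ → trans (proj₂ (to (entry-tableau V p i _) 1ᵢₖ)) (cong (fromMaybe i) e))
  ... | nothing = parentOf-none λ i<k 1ᵢₖ →
        ℕ.<-irrefl (cong toℕ (sym (trans (proj₂ (to (entry-tableau V p i _) 1ᵢₖ)) (cong (fromMaybe i) e)))) i<k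

  forestOf-tableau : forestOf (tableau (V , p)) ≡ (V , p)
  forestOf-tableau = cong₂ _,_ (tabulate-≗lookup rowNonzero-tableau) (tabulate-≗lookup parentOf-tableau)

tableau-isTesler : {a : Vec ℕ n} {V : Subset n} {p : ParentMap n} → IsGoodPair a V p → IsTesler a (tableau (V , p))
tableau-isTesler {V = V} {p} γ = record
  { staircase        = λ {i} {j} 1ᵢⱼ →
      subst (i ≤_) (sym (proj₂ (to (entry-tableau V p i j) 1ᵢⱼ))) (i≤column forest i)
  ; positive⇒nonzero = λ {i} pos → subst T (sym (rowNonzero-tableau forest i)) (positive∈V pos)
  ; column⇒nonzero   = λ {i} {j} i<j 1ᵢⱼ → subst T (sym (rowNonzero-tableau forest j))
      (parent∈V (column-parent {p = p} (proj₂ (to (entry-tableau V p i j) 1ᵢⱼ)) i<j))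
  ; emptyColumn⇒zero = λ {j} ¬pos empty nz →
      let u , e = nonpositive⇒child (subst T (rowNonzero-tableau forest j) nz) ¬pos in
      empty (child<parent e) (from (entry-tableau V p u j) (child∈V e , sym (cong (fromMaybe u) e)))
  }
  where
  open IsGoodPair γ
  open IsDecreasingForest forest

module _ {a : Vec ℕ n} {t : Filling n} (τ : IsTesler a t) (functional : RowFunctional t) where
  open IsTesler τ

  private
    V : Subset n
    V = proj₁ (forestOf t)
    p : ParentMap n
    p = proj₂ (forestOf t)

    ∈V : ∀ {v} → T (rowNonzero t v) → T (lookup V v)
    ∈V {v} = subst T (sym (Vec.lookup∘tabulate (rowNonzero t) v))

    lookup-p : ∀ {v u} → lookup p v ≡ just u → parentOf t v ≡ just u
    lookup-p {v} = trans (sym (Vec.lookup∘tabulate (parentOf t) v))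

  parentOf-entry : ∀ {i j} → i < j → T (entry t i j) → parentOf t i ≡ just j
  parentOf-entry i<j 1ᵢⱼ = parentOf-unique i<j 1ᵢⱼ λ i<k 1ᵢₖ → functional (ℕ.<⇒≤ i<k) (ℕ.<⇒≤ i<j) 1ᵢₖ 1ᵢⱼ

  forestOf-isDecreasingForest : IsDecreasingForest V p
  forestOf-isDecreasingForest = record
    { child∈V      = λ {v} {u} e → let v<u , 1ᵥᵤ = parentOf-just (lookup-p e) in
                       ∈V (from (T-rowNonzero t v) (u , ℕ.<⇒≤ v<u , 1ᵥᵤ))
    ; parent∈V     = λ e → ∈V (uncurry column⇒nonzero (parentOf-just (lookup-p e)))
    ; child<parent = λ e → proj₁ (parentOf-just (lookup-p e))
    }

  forestOf-child : ∀ {v} → T (lookup V v) → ¬ T (positive (lookup a v)) → ∃[ u ] lookup p u ≡ just v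
  forestOf-child {v} v∈V ¬pos with any? (λ i → i <? v ×-dec T? (entry t i v))
  ... | yes (u , u<v , 1ᵤᵥ) = u , trans (Vec.lookup∘tabulate (parentOf t) u) (parentOf-entry u<v 1ᵤᵥ)
  ... | no none = ⊥-elim (emptyColumn⇒zero ¬pos (λ i<v 1ᵢᵥ → none (_ , i<v , 1ᵢᵥ))
                    (subst T (Vec.lookup∘tabulate (rowNonzero t) v) v∈V))

  forestOf-isGoodPair : IsGoodPair a V p
  forestOf-isGoodPair = record
    { positive∈V        = ∈V ∘ positive⇒nonzero
    ; forest            = forestOf-isDecreasingForest
    ; nonpositive⇒child = forestOf-child
    }

  diagonal-if-root : ∀ {i j} → parentOf t i ≡ nothing → T (entry t i j) → j ≡ i
  diagonal-if-root e 1ᵢⱼ with ℕ.m≤n⇒m<n∨m≡n (staircase 1ᵢⱼ)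
  ... | inj₁ i<j = ⊥-elim (parentOf-nothing e i<j 1ᵢⱼ)
  ... | inj₂ i≡j = sym (toℕ-injective i≡j)

  entry⇒column : ∀ {i j} → T (entry t i j) → j ≡ fromMaybe i (parentOf t i)
  entry⇒column {i} 1ᵢⱼ with parentOf t i in e
  ... | just u  = let i<u , 1ᵢᵤ = parentOf-just e in functional (staircase 1ᵢⱼ) (ℕ.<⇒≤ i<u) 1ᵢⱼ 1ᵢᵤ
  ... | nothing = diagonal-if-root e 1ᵢⱼ

  nonzero⇒column : ∀ {i} → T (rowNonzero t i) → T (entry t i (fromMaybe i (parentOf t i)))
  nonzero⇒column {i} nz with parentOf t i in e
  ... | just u  = proj₂ (parentOf-just e)
  ... | nothing = let j , _ , 1ᵢⱼ = to (T-rowNonzero t i) nz in subst (T ∘ entry t i) (diagonal-if-root e 1ᵢⱼ) 1ᵢⱼ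

  tableau-forestOf : tableau (forestOf t) ≡ t
  tableau-forestOf = tabulate-≗lookup λ i → tabulate-≗lookup λ j → begin
    lookup V i ∧ (j =ᶠ column p i)
      ≡⟨ cong₂ (λ b m → b ∧ (j =ᶠ fromMaybe i m)) (Vec.lookup∘tabulate _ i) (Vec.lookup∘tabulate _ i) ⟩
    rowNonzero t i ∧ (j =ᶠ fromMaybe i (parentOf t i))
      ≡⟨ T-injective (mk⇔
           (λ h → let nz , j=col = to (T-∧ {rowNonzero t i}) h in
              subst (T ∘ entry t i) (sym (to T-=ᶠ j=col)) (nonzero⇒column nz))
           (λ 1ᵢⱼ → from (T-∧ {rowNonzero t i})
              (from (T-rowNonzero t i) (j , staircase 1ᵢⱼ , 1ᵢⱼ) , from T-=ᶠ (entry⇒column 1ᵢⱼ)))) ⟩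
    entry t i j
      ∎
    where open ≡-Reasoning

lemma6p2 : (n : ℕ) (a : Vec ℕ n) → numDim0Tesler a ≡ numGoodPairs a
lemma6p2 n a = length-filterᵇ-bijection allFillings-isEnumeration allPairs-isEnumeration forestOf tableau
  (λ h → let τ , f = dim0 h in from T-isGoodPair (forestOf-isGoodPair τ f))
  (λ {vp} g → from T-isDim0Tesler (tableau-isTesler (good {vp} g) , tableau-rowFunctional (proj₁ vp) (proj₂ vp)))
  (λ h → let τ , f = dim0 h in tableau-forestOf τ f)
  (λ {vp} g → forestOf-tableau (IsGoodPair.forest (good {vp} g)))
  where
  dim0 : ∀ {t} → T (isDim0Tesler a t) → IsTesler a t × RowFunctional t
  dim0 = to T-isDim0Tesler
  good : ∀ {vp} → T (isGoodPair a vp) → IsGoodPair a (proj₁ vp) (proj₂ vp)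
  good = to T-isGoodPair
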